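{- Let $q$ be a prime power, $n$ a positive integer coprime to $q$, $\gamma\in\mathbb{Z}/n\mathbb{Z}$, and $\omega_\gamma$ as in the context. Then $$c_{n/q}(\gamma)=\bigsqcup_{j=0}^{\omega_\gamma-1}c_{n/q^{\omega_\gamma}}(\gamma q^j)$$ is the unique coarsest equal-difference decomposition of $c_{n/q}(\gamma)$.
   Context: For $N$ coprime to $n$ (e.g. $N=q^t$), $c_{n/N}(\gamma)=\{\gamma,\gamma N,\dots,\gamma N^{\sigma-1}\}\subseteq\mathbb{Z}/n\mathbb{Z}$ with $\sigma$ least positive such that $\gamma N^\sigma\equiv\gamma\pmod n$. A subset $E\subseteq c_{n/q}(\gamma)$ with $|E|=\tau_E$ is an equal-difference subset if $\tau_E\mid n$ and $E=\{e,e+\frac n{\tau_E},\dots,e+(\tau_E-1)\frac n{\tau_E}\}$ in $\mathbb{Z}/n\mathbb{Z}$ for some $e\in E$; an equal-difference decomposition of $c_{n/q}(\gamma)$ is a partition into disjoint equal-difference subsets. For two such decompositions, $\bigsqcup_{i\in I}E_i$ is coarser than $\bigsqcup_{j\in J}E'_j$ if $J=\bigsqcup_{i\in I}J_i$ with $E_i=\bigsqcup_{j\in J_i}E'_j$ for each $i$; the coarsest one is coarser than every equal-difference decomposition. With $n_\gamma=n/\gcd(\gamma,n)$, $\mathrm{rad}(m)$ the product of distinct primes dividing $m$, $\mathrm{ord}_m(q)$ the order of $q$ mod $m$: $\omega_\gamma=2\,\mathrm{ord}_{\mathrm{rad}(n_\gamma)}(q)$ if $q^{\mathrm{ord}_{\mathrm{rad}(n_\gamma)}(q)}\equiv3\pmod4$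 and $8\mid n_\gamma$, and $\omega_\gamma=\mathrm{ord}_{\mathrm{rad}(n_\gamma)}(q)$ otherwise. -}

module Defs where

open import Level using (0ℓ)
open import Data.Nat using (ℕ; zero; suc; _+_; _*_; _∸_; _^_; _<_; _≤_; NonZero; ≢-nonZero; ≢-nonZero⁻¹)
open import Data.Nat.DivMod using (_/_; _%_)
open import Data.Nat.Divisibility using (_∣_; _∣?_)
open import Data.Nat.GCD using (gcd; gcd[m,n]≢0)
open import Data.Nat.Primality using (Prime; prime?)
open import Data.List using (List; filter; upTo)
open import Data.Nat.ListAction using (product)
open import Data.Fin using (Fin; toℕ)
open import Data.Product using (Σ; ∃; ∃-syntax; _×_; _,_)
open import Data.Sum using (inj₂)
open import Relation.Nullary using (¬_; yes; no)
open import Relation.Nullary.Decidable using (_×-dec_)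
open import Relation.Binary.PropositionalEquality using (_≡_; _≢_)
open import Function.Bundles using (_⇔_)

-- Elements of ℤ/nℤ are represented by their residues in ℕ (values < n);
-- subsets of ℤ/nℤ are predicates on ℕ.
Subset : Set₁
Subset = ℕ → Set

_≐_ : Subset → Subset → Set
A ≐ B = ∀ x → A x ⇔ B x

-- c_{n/N}(γ) = {γ, γN, …, γN^(σ-1)} mod n  =  { γ N^i mod n : i ∈ ℕ }
cyc : (n : ℕ) .{{_ : NonZero n}} → (N γ : ℕ) → Subset
cyc n N γ x = ∃[ i ] (x ≡ (γ * N ^ i) % n)

-- E is an equal-difference subset of ℤ/nℤ: for some τ with τ ∣ n (n = d·τ, so d = n/τ)
-- and some e ∈ E, E = {e, e + n/τ, …, e + (τ-1) n/τ} (mod n).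
-- (Such a set automatically has exactly τ elements.)
IsEqualDiff : (n : ℕ) .{{_ : NonZero n}} → Subset → Set
IsEqualDiff n E =
  ∃[ τ ] ∃[ d ] (n ≡ d * τ × ∃[ e ] (E e ×
     (∀ x → E x ⇔ (∃[ k ] (k < τ × x ≡ (e + k * d) % n)))))

IsEDDecomp : (n : ℕ) .{{_ : NonZero n}} → Subset → (k : ℕ) → (Fin k → Subset) → Set
IsEDDecomp n C k E =
  (∀ i → IsEqualDiff n (E i)) ×
  (∀ i j → i ≢ j → ∀ x → E i x → ¬ E j x) ×
  (∀ x → C x ⇔ (∃[ i ] E i x))

-- ⊔_{i∈I} E_i is coarser than ⊔_{j∈J} E'_j : J = ⊔_{i} J_i with E_i = ⊔_{j∈J_i} E'_j.
-- The partition J = ⊔ J_i is encoded by the map f : J → I, J_i = f⁻¹(i).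
Coarser : (k : ℕ) → (Fin k → Subset) → (k' : ℕ) → (Fin k' → Subset) → Set
Coarser k E k' E' =
  Σ (Fin k' → Fin k) λ f → ∀ i → E i ≐ (λ x → ∃[ j ] (f j ≡ i × E' j x))

SameBlocks : (k : ℕ) → (Fin k → Subset) → (k' : ℕ) → (Fin k' → Subset) → Set
SameBlocks k E k' E' =
  (∀ i → ∃[ j ] (E i ≐ E' j)) × (∀ j → ∃[ i ] (E' j ≐ E i))

IsPrimePower : ℕ → Set
IsPrimePower q = ∃[ p ] ∃[ t ] (Prime p × 1 ≤ t × q ≡ p ^ t)

nγ : (n : ℕ) .{{_ : NonZero n}} → ℕ → ℕ
nγ n γ = _/_ n (gcd γ n) {{≢-nonZero (gcd[m,n]≢0 γ n (inj₂ (≢-nonZero⁻¹ n)))}}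

rad : ℕ → ℕ
rad m = product (filter (λ p → prime? p ×-dec (p ∣? m)) (upTo (suc m)))

IsOrd : (m q t : ℕ) → Set
IsOrd m q t = 1 ≤ t × m ∣ (q ^ t ∸ 1) × (∀ s → 1 ≤ s → m ∣ (q ^ s ∸ 1) → t ≤ s)

omega : (n : ℕ) .{{_ : NonZero n}} → (γ q o : ℕ) → ℕ
omega n γ q o with (q ^ o) % 4 Data.Nat.≟ 3 | 8 ∣? nγ n γ
... | yes _ | yes _ = 2 * o
... | _     | _     = o

blocks : (n : ℕ) .{{_ : NonZero n}} → (γ q ω : ℕ) → Fin ω → Subset
blocks n γ q ω j = cyc n (q ^ ω) (γ * q ^ toℕ j)

module Submission where

-- Write n = g N with g = gcd(γ, n) and N = n_γ, so that γ = g γ′ with γ′ a unit modulo N.  The key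
-- observation is that ω_γ is the multiplicative order of q modulo ρ = rad N, resp. lcm(rad N, 4)
-- when 8 ∣ N.  Since γ q^c ≡ γ q^a (mod n) iff q^c ≡ q^a (mod N), which implies the congruence
-- modulo ρ, the blocks c_{n/q^ω}(γ q^j) are pairwise disjoint, and they clearly cover c_{n/q}(γ).
-- Each block is the orbit of γ q^j under Q = q^ω = 1 + R with ρ ∣ R; for D = gcd(R, N) and
-- τ = N / D the lifting-the-exponent lemma (τ ∣ 1 + Q + ⋯ + Q^(k-1) implies τ ∣ k) shows that
-- this orbit is {γ q^j + k g D : k < τ}.  Conversely, if E ⊆ c_{n/q}(γ) is equal-difference with
-- step d, then g ∣ d and the progression divided by g consists of units modulo N lying in γ′⟨q⟩.
-- So every prime of N divides d / g (else some term vanishes modulo that prime), and 4 ∣ d / g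
-- when 8 ∣ N (powers of q take just two values modulo 8); hence ρ ∣ d / g, all exponents occurring
-- in E agree modulo ω, and E lies in a single block.  Uniqueness of the coarsest decomposition is
-- then formal.

open import Defs
open import Data.Nat using (ℕ; _<_; _^_; NonZero)
open import Data.Nat.Coprimality using (Coprime)
open import Data.Fin using (Fin)
open import Data.Product using (_×_)

open import Data.Nat.Base using (zero; suc; _+_; _*_; _∸_; _≤_; z≤n; s≤s; ≢-nonZero; ≢-nonZero⁻¹; >-nonZero)
open import Data.Nat.Properties
  using (_≟_; <-cmp; ≤-total; <⇒≱; ≤-<-trans; n<1+n; m≤n+m; +-comm; +-suc; +-identityʳ; *-comm; *-assoc;
         *-identityˡ; *-identityʳ; *-zeroʳ; m<m*n; m*n≢0; m*n≢0⇒m≢0; ^-*-assoc; ^-zeroˡ; ^-distribˡ-+-*;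
         m^n≢0; m^n>0; m+[n∸m]≡n; even≢odd)
open import Data.Nat.DivMod
  using (_%_; _/_; m%n<n; m≡m%n+[m/n]*n; [m+kn]%n≡m%n; %-remove-+ʳ; m<n⇒m%n≡m; m*[n/m]≡n)
open import Data.Nat.Divisibility
  using (_∣_; _∣?_; divides; ∣-refl; ∣-trans; 1∣_; _∣0; 0∣⇒≡0; ∣1⇒≡1; n∣m*n; m∣m*n; ∣m⇒∣m*n; ∣n⇒∣m*n;
         ∣m+n∣m⇒∣n; *-pres-∣; *-monoˡ-∣; *-cancelˡ-∣; *-cancelʳ-∣; ∣⇒≤; m%n≡0⇒n∣m)
open import Data.Nat.GCD using (gcd; gcd[m,n]∣m; gcd[m,n]∣n; gcd[m,n]≢0; gcd-greatest; module Bézout)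
open import Data.Nat.LCM using (lcm; lcm-least; m∣lcm[m,n]; n∣lcm[m,n]; gcd*lcm)
open import Data.Nat.Coprimality as Coprime
  using (coprime-divisor; coprime⇒gcd≡1; coprime-Bézout; coprime-/gcd; 1-coprimeTo)
open import Data.Nat.Primality using (Prime; prime?; prime[2]; prime⇒irreducible; prime⇒nonZero)
open import Data.Nat.Primality.Factorisation using (factorise; factorisationHasAllPrimeFactors)
open import Data.Nat.ListAction using (product)
open import Data.Nat.ListAction.Properties using (∈⇒∣product)
open import Data.Nat.Induction using (<-rec)
open import Data.Nat.Tactic.RingSolver using (solve-∀)
open import Data.Integer.Base as ℤ using (+_)
import Data.Integer.Properties as ℤ
import Data.Integer.Divisibility.Signed as ℤ∣
open import Data.Integer.Tactic.RingSolver renaming (solve-∀ to ℤ-solve-∀)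
open import Data.List.Base using ([]; _∷_; upTo)
open import Data.List.Relation.Unary.All as All using (All; _∷_)
open import Data.List.Relation.Unary.All.Properties using (all-filter)
open import Data.List.Relation.Unary.Any using (here; there)
open import Data.List.Relation.Unary.AllPairs using (_∷_)
open import Data.List.Relation.Unary.Unique.Propositional using (Unique)
import Data.List.Relation.Unary.Unique.Propositional.Properties as Unique
open import Data.List.Membership.Propositional using (_∈_)
open import Data.List.Membership.Propositional.Properties using (∈-filter⁺; ∈-filter⁻; ∈-upTo⁺)
open import Data.Fin.Base using (toℕ; fromℕ<; punchOut)
open import Data.Fin.Properties
  using (any?; punchOut-injective; <⇒notInjective; toℕ-injective; toℕ<n; toℕ-fromℕ<; fromℕ<-cong)
  renaming (_≟_ to _≟ᶠ_)
open import Data.Product.Base using (∃-syntax; _,_; proj₁; proj₂)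
open import Data.Sum.Base as Sum using (_⊎_; inj₁; inj₂)
open import Data.Empty using (⊥; ⊥-elim)
open import Function.Bundles using (_⇔_; mk⇔; Equivalence)
open import Function.Definitions using (Injective)
import Function.Properties.Equivalence as ⇔
open import Relation.Nullary using (¬_; yes; no)
open import Relation.Nullary.Negation using (contradiction)
open import Relation.Nullary.Decidable using (_×-dec_)
open import Relation.Unary using (Satisfiable)
open import Relation.Binary.Bundles using (Setoid)
open import Relation.Binary.Structures using (IsEquivalence)
open import Relation.Binary.Definitions using (tri<; tri≈; tri>)
import Relation.Binary.Reasoning.Setoid as SetoidReasoning
open import Relation.Binary.PropositionalEquality
  using (_≡_; _≢_; refl; sym; trans; cong; cong₂; subst; subst₂; module ≡-Reasoning)
open Equivalence using (to; from)
open _∣_ using (quotient; equality)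

-- Congruences of natural numbers

-- A record rather than a definition, so that x, y and m can be inferred from the type.
infix 4 _≡_mod_
record _≡_mod_ (x y m : ℕ) : Set where
  constructor mk≡mod
  field divides-difference : + m ℤ∣.∣ (+ x ℤ.- + y)
open _≡_mod_

module _ {m : ℕ} where

  ≡mod-refl : ∀ {x} → x ≡ x mod m
  ≡mod-refl {x} = mk≡mod (ℤ∣.divides (+ 0) (ℤ.+-inverseʳ (+ x)))

  ≡mod-sym : ∀ {x y} → x ≡ y mod m → y ≡ x mod m
  ≡mod-sym {x} {y} (mk≡mod m∣x-y) = mk≡mod (subst (ℤ∣._∣_ _) (negate (+ x) (+ y)) (ℤ∣.∣m⇒∣-m m∣x-y))
    where
    negate : ∀ a b → ℤ.- (a ℤ.- b) ≡ b ℤ.- a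
    negate = ℤ-solve-∀

  ≡mod-trans : ∀ {x y z} → x ≡ y mod m → y ≡ z mod m → x ≡ z mod m
  ≡mod-trans {x} {y} {z} (mk≡mod m∣x-y) (mk≡mod m∣y-z) =
    mk≡mod (subst (ℤ∣._∣_ _) (telescope (+ x) (+ y) (+ z)) (ℤ∣.∣m∣n⇒∣m+n m∣x-y m∣y-z))
    where
    telescope : ∀ a b c → (a ℤ.- b) ℤ.+ (b ℤ.- c) ≡ a ℤ.- c
    telescope = ℤ-solve-∀

  ≡mod-reflexive : ∀ {x y} → x ≡ y → x ≡ y mod m
  ≡mod-reflexive refl = ≡mod-refl

  ≡mod-isEquivalence : IsEquivalence (λ x y → x ≡ y mod m)
  ≡mod-isEquivalence = record { refl = ≡mod-refl ; sym = ≡mod-sym ; trans = ≡mod-trans }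

  ≡mod-+ : ∀ {a b c d} → a ≡ b mod m → c ≡ d mod m → a + c ≡ b + d mod m
  ≡mod-+ {a} {b} {c} {d} (mk≡mod m∣a-b) (mk≡mod m∣c-d) = mk≡mod (subst (ℤ∣._∣_ _) eq (ℤ∣.∣m∣n⇒∣m+n m∣a-b m∣c-d))
    where
    regroup : ∀ a b c d → (a ℤ.- b) ℤ.+ (c ℤ.- d) ≡ (a ℤ.+ c) ℤ.- (b ℤ.+ d)
    regroup = ℤ-solve-∀
    eq = trans (regroup (+ a) (+ b) (+ c) (+ d)) (sym (cong₂ ℤ._-_ (ℤ.pos-+ a c) (ℤ.pos-+ b d)))

  ≡mod-* : ∀ {a b c d} → a ≡ b mod m → c ≡ d mod m → a * c ≡ b * d mod m
  ≡mod-* {a} {b} {c} {d} (mk≡mod m∣a-b) (mk≡mod m∣c-d) =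
    mk≡mod (subst (ℤ∣._∣_ _) eq (ℤ∣.∣m∣n⇒∣m+n (ℤ∣.∣m⇒∣m*n (+ c) m∣a-b) (ℤ∣.∣n⇒∣m*n (+ b) m∣c-d)))
    where
    regroup : ∀ a b c d → (a ℤ.- b) ℤ.* c ℤ.+ b ℤ.* (c ℤ.- d) ≡ a ℤ.* c ℤ.- b ℤ.* d
    regroup = ℤ-solve-∀
    eq = trans (regroup (+ a) (+ b) (+ c) (+ d)) (sym (cong₂ ℤ._-_ (ℤ.pos-* a c) (ℤ.pos-* b d)))

  ≡mod-+ˡ : ∀ a {x y} → x ≡ y mod m → a + x ≡ a + y mod m
  ≡mod-+ˡ a = ≡mod-+ (≡mod-refl {x = a})

  ≡mod-+ʳ : ∀ a {x y} → x ≡ y mod m → x + a ≡ y + a mod m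
  ≡mod-+ʳ a x≡y = ≡mod-+ x≡y (≡mod-refl {x = a})

  ≡mod-*ˡ : ∀ a {x y} → x ≡ y mod m → a * x ≡ a * y mod m
  ≡mod-*ˡ a = ≡mod-* (≡mod-refl {x = a})

  ≡mod-^ : ∀ {a b} k → a ≡ b mod m → a ^ k ≡ b ^ k mod m
  ≡mod-^ zero    a≡b = ≡mod-refl
  ≡mod-^ (suc k) a≡b = ≡mod-* a≡b (≡mod-^ k a≡b)

  ≡mod⇔∣∸ : ∀ {x y} → y ≤ x → x ≡ y mod m ⇔ m ∣ x ∸ y
  ≡mod⇔∣∸ {x} {y} y≤x = mk⇔ (λ x≡y → ℤ∣.∣⇒∣ᵤ (subst (ℤ∣._∣_ _) difference (divides-difference x≡y)))
                            (λ m∣x∸y → mk≡mod (subst (ℤ∣._∣_ _) (sym difference) (ℤ∣.∣ᵤ⇒∣ m∣x∸y)))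
    where
    difference : + x ℤ.- + y ≡ + (x ∸ y)
    difference = trans (ℤ.m-n≡m⊖n x y) (ℤ.⊖-≥ y≤x)

  ≡0mod⇔∣ : ∀ {x} → x ≡ 0 mod m ⇔ m ∣ x
  ≡0mod⇔∣ = ≡mod⇔∣∸ z≤n

  ≡mod-∣ : ∀ {d x y} → d ∣ m → x ≡ y mod m → x ≡ y mod d
  ≡mod-∣ d∣m (mk≡mod m∣x-y) = mk≡mod (ℤ∣.∣-trans (ℤ∣.∣ᵤ⇒∣ d∣m) m∣x-y)

  ≡mod-+-multiple : ∀ a k → a + k * m ≡ a mod m
  ≡mod-+-multiple a k = subst (λ z → a + k * m ≡ z mod m) (+-identityʳ a)
    (≡mod-+ˡ a (from ≡0mod⇔∣ (n∣m*n k)))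

  ≡mod-+-cancelˡ : ∀ a {x y} → a + x ≡ a + y mod m → x ≡ y mod m
  ≡mod-+-cancelˡ a {x} {y} (mk≡mod m∣a+x-a+y) =
    mk≡mod (subst (ℤ∣._∣_ _) (trans (cong₂ ℤ._-_ (ℤ.pos-+ a x) (ℤ.pos-+ a y)) (cancel (+ a) (+ x) (+ y))) m∣a+x-a+y)
    where
    cancel : ∀ a x y → (a ℤ.+ x) ℤ.- (a ℤ.+ y) ≡ x ℤ.- y
    cancel = ℤ-solve-∀

≡1⇒^≡1 : ∀ {m x} t → x ≡ 1 mod m → x ^ t ≡ 1 mod m
≡1⇒^≡1 t x≡1 = ≡mod-trans (≡mod-^ t x≡1) (≡mod-reflexive (^-zeroˡ t))

^≡1⇒^*≡1 : ∀ {m x k} t → x ^ k ≡ 1 mod m → x ^ (t * k) ≡ 1 mod m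
^≡1⇒^*≡1 {x = x} {k} t x^k≡1 =
  subst (_≡ 1 mod _) (trans (^-*-assoc x k t) (cong (x ^_) (*-comm k t))) (≡1⇒^≡1 t x^k≡1)

private
  ∣scaled : ∀ {k c x y} → c * x ≡ c * y mod k → k ∣ c * ℤ.∣ + x ℤ.- + y ∣
  ∣scaled {k} {c} {x} {y} (mk≡mod k∣cx-cy) =
    subst (k ∣_) (ℤ.abs-* (+ c) (+ x ℤ.- + y)) (ℤ∣.∣⇒∣ᵤ (subst (ℤ∣._∣_ _) scale k∣cx-cy))
    where
    factor : ∀ c x y → c ℤ.* x ℤ.- c ℤ.* y ≡ c ℤ.* (x ℤ.- y)
    factor = ℤ-solve-∀
    scale = trans (cong₂ ℤ._-_ (ℤ.pos-* c x) (ℤ.pos-* c y)) (factor (+ c) (+ x) (+ y))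

≡mod-*-cancelˡ : ∀ {m c x y} → Coprime m c → c * x ≡ c * y mod m → x ≡ y mod m
≡mod-*-cancelˡ {c = c} coprime cx≡cy = mk≡mod (ℤ∣.∣ᵤ⇒∣ (coprime-divisor coprime (∣scaled {c = c} cx≡cy)))

≡mod-*-cancelˡ-modulus : ∀ {g m x y} .{{_ : NonZero g}} → g * x ≡ g * y mod g * m → x ≡ y mod m
≡mod-*-cancelˡ-modulus {g} gx≡gy = mk≡mod (ℤ∣.∣ᵤ⇒∣ (*-cancelˡ-∣ g (∣scaled {c = g} gx≡gy)))

≡mod-lcm : ∀ {a b x y} → x ≡ y mod a → x ≡ y mod b → x ≡ y mod lcm a b
≡mod-lcm (mk≡mod a∣x-y) (mk≡mod b∣x-y) = mk≡mod (ℤ∣.∣ᵤ⇒∣ (lcm-least (ℤ∣.∣⇒∣ᵤ a∣x-y) (ℤ∣.∣⇒∣ᵤ b∣x-y)))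

module _ {m : ℕ} .{{_ : NonZero m}} where

  %≡mod : ∀ x → x % m ≡ x mod m
  %≡mod x = subst (λ z → x % m ≡ z mod m) (sym (m≡m%n+[m/n]*n x m))
    (≡mod-sym (≡mod-+-multiple (x % m) (x / m)))

  %≡%⇒≡mod : ∀ {x y} → x % m ≡ y % m → x ≡ y mod m
  %≡%⇒≡mod {x} {y} eq = ≡mod-trans (≡mod-sym (%≡mod x)) (≡mod-trans (≡mod-reflexive eq) (%≡mod y))

  ∣∸⇒%≡% : ∀ {a b} → a ≤ b → m ∣ b ∸ a → a % m ≡ b % m
  ∣∸⇒%≡% {a} {b} a≤b (divides k b∸a≡km) = begin
    a % m             ≡⟨ [m+kn]%n≡m%n a k m ⟨
    (a + k * m) % m   ≡⟨ cong (λ z → (a + z) % m) b∸a≡km ⟨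
    (a + (b ∸ a)) % m ≡⟨ cong (_% m) (m+[n∸m]≡n a≤b) ⟩
    b % m             ∎
    where open ≡-Reasoning

  *≡%*mod : ∀ {n} k d → n ≡ d * m → k * d ≡ (k % m) * d mod n
  *≡%*mod k d refl = ≡mod-trans (≡mod-reflexive split) (≡mod-+-multiple ((k % m) * d) (k / m))
    where
    regroup : ∀ r t d m → (r + t * m) * d ≡ r * d + t * (d * m)
    regroup = solve-∀
    split : k * d ≡ (k % m) * d + (k / m) * (d * m)
    split = trans (cong (_* d) (m≡m%n+[m/n]*n k m)) (regroup (k % m) (k / m) d m)

  ≡mod⇒%≡% : ∀ {x y} → x ≡ y mod m → x % m ≡ y % m
  ≡mod⇒%≡% {x} {y} x≡y with ≤-total y x
  ... | inj₁ y≤x = sym (∣∸⇒%≡% y≤x (to (≡mod⇔∣∸ y≤x) x≡y))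
  ... | inj₂ x≤y = ∣∸⇒%≡% x≤y (to (≡mod⇔∣∸ x≤y) (≡mod-sym x≡y))

≡mod-setoid : ℕ → Setoid _ _
≡mod-setoid m = record { isEquivalence = ≡mod-isEquivalence {m} }

module ≡mod-Reasoning (m : ℕ) = SetoidReasoning (≡mod-setoid m)


-- Odd numbers modulo 4 and 8

even⊎odd : ∀ n → ∃[ h ] (n ≡ h * 2 ⊎ n ≡ suc (h * 2))
even⊎odd zero          = 0 , inj₁ refl
even⊎odd (suc zero)    = 0 , inj₂ refl
even⊎odd (suc (suc n)) with even⊎odd n
... | h , inj₁ n≡2h  = suc h , inj₁ (cong (_+_ 2) n≡2h)
... | h , inj₂ n≡2h+1 = suc h , inj₂ (cong (_+_ 2) n≡2h+1)

¬2∣odd : ∀ h → ¬ 2 ∣ suc (h * 2)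
¬2∣odd h (divides k eq) = even≢odd k h (trans (*-comm 2 k) (trans (sym eq) (cong suc (*-comm h 2))))

odd-mod4 : ∀ {x} → ¬ 2 ∣ x → ∃[ g ] (x ≡ 1 + g * 4 ⊎ x ≡ 3 + g * 4)
odd-mod4 {x} x-odd with even⊎odd x
... | h , inj₁ x≡2h = contradiction (divides h x≡2h) x-odd
... | h , inj₂ refl with even⊎odd h
...   | g , inj₁ refl = g , inj₁ (cong suc (*-assoc g 2 2))
...   | g , inj₂ refl = g , inj₂ (cong (_+_ 3) (*-assoc g 2 2))

odd*odd≡1mod8 : ∀ {x} → ¬ 2 ∣ x → x * x ≡ 1 mod 8
odd*odd≡1mod8 x-odd with odd-mod4 x-odd
... | g , inj₁ refl = ≡mod-trans (≡mod-reflexive (square g)) (≡mod-+-multiple 1 (g + g * g * 2))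
  where
  square : ∀ g → (1 + g * 4) * (1 + g * 4) ≡ 1 + (g + g * g * 2) * 8
  square = solve-∀
... | g , inj₂ refl = ≡mod-trans (≡mod-reflexive (square g)) (≡mod-+-multiple 1 (1 + g * 3 + g * g * 2))
  where
  square : ∀ g → (3 + g * 4) * (3 + g * 4) ≡ 1 + (1 + g * 3 + g * g * 2) * 8
  square = solve-∀

odd^≡1∨self : ∀ {x} → ¬ 2 ∣ x → ∀ c → x ^ c ≡ 1 mod 8 ⊎ x ^ c ≡ x mod 8
odd^≡1∨self x-odd zero = inj₁ ≡mod-refl
odd^≡1∨self {x} x-odd (suc c) with odd^≡1∨self x-odd c
... | inj₁ x^c≡1 = inj₂ (≡mod-trans (≡mod-*ˡ x x^c≡1) (≡mod-reflexive (*-identityʳ x)))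
... | inj₂ x^c≡x = inj₁ (≡mod-trans (≡mod-*ˡ x x^c≡x) (odd*odd≡1mod8 x-odd))

odd∧≢3mod4⇒≡1 : ∀ {x} → ¬ 2 ∣ x → x % 4 ≢ 3 → x ≡ 1 mod 4
odd∧≢3mod4⇒≡1 x-odd x≢3 with odd-mod4 x-odd
... | g , inj₁ refl = ≡mod-+-multiple 1 g
... | g , inj₂ refl = contradiction ([m+kn]%n≡m%n 3 g 4) x≢3

≡3mod4⇒^2≡1 : ∀ {x} → x ≡ 3 mod 4 → x ^ 2 ≡ 1 mod 4
≡3mod4⇒^2≡1 x≡3 = ≡mod-trans (≡mod-^ 2 x≡3) (≡mod-+-multiple 1 2)

≡3mod4⇒[^≡1⇔2∣] : ∀ {x} → x ≡ 3 mod 4 → ∀ t → x ^ t ≡ 1 mod 4 ⇔ 2 ∣ t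
≡3mod4⇒[^≡1⇔2∣] {x} x≡3 t with even⊎odd t
... | h , inj₁ refl = mk⇔ (λ _ → divides h refl) (λ _ → ^≡1⇒^*≡1 h (≡3mod4⇒^2≡1 x≡3))
... | h , inj₂ refl = mk⇔ (λ x^t≡1 → contradiction (≡mod⇒%≡% (≡mod-trans (≡mod-sym x^t≡3) x^t≡1)) λ ())
                          (λ 2∣t → contradiction 2∣t (¬2∣odd h))
  where
  x^t≡3 : x ^ suc (h * 2) ≡ 3 mod 4
  x^t≡3 = ≡mod-* x≡3 (^≡1⇒^*≡1 h (≡3mod4⇒^2≡1 x≡3))

coprime∧8∣⇒odd : ∀ {a N} → Coprime a N → 8 ∣ N → ¬ 2 ∣ a
coprime∧8∣⇒odd coprime 8∣N 2∣a = contradiction (coprime (2∣a , ∣-trans (divides 4 refl) 8∣N)) λ ()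


-- Primes, coprimality and radicals

prime≢1 : ∀ {p} → Prime p → p ≢ 1
prime≢1 {suc (suc _)} _ ()

prime>1 : ∀ {p} → Prime p → 1 < p
prime>1 {suc (suc _)} _ = s≤s (s≤s z≤n)

prime∣prime⇒≡ : ∀ {p q} → Prime p → Prime q → p ∣ q → p ≡ q
prime∣prime⇒≡ p-prime q-prime p∣q with prime⇒irreducible q-prime p∣q
... | inj₁ p≡1 = contradiction p≡1 (prime≢1 p-prime)
... | inj₂ p≡q = p≡q

∃prime∣ : ∀ {n} → n ≢ 1 → ∃[ p ] (Prime p × p ∣ n)
∃prime∣ {zero}        _   = 2 , prime[2] , 2 ∣0
∃prime∣ {suc zero}    n≢1 = contradiction refl n≢1
∃prime∣ {n@(suc (suc _))} _ with factorise n
... | record { factors = p ∷ ps ; isFactorisation = n≡∏ ; factorsPrime = p-prime ∷ _ } =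
  p , p-prime , subst (p ∣_) (sym n≡∏) (∈⇒∣product {ns = p ∷ ps} (here refl))

no-common-prime⇒coprime : ∀ {a b} → (∀ {p} → Prime p → p ∣ a → p ∣ b → ⊥) → Coprime a b
no-common-prime⇒coprime {a} {b} no-common {d} (d∣a , d∣b) with d ≟ 1
... | yes d≡1 = d≡1
... | no d≢1 with ∃prime∣ d≢1
...   | p , p-prime , p∣d = ⊥-elim (no-common p-prime (∣-trans p∣d d∣a) (∣-trans p∣d d∣b))

prime∤⇒coprime : ∀ {p d} → Prime p → ¬ p ∣ d → Coprime p d
prime∤⇒coprime p-prime p∤d {e} (e∣p , e∣d) with prime⇒irreducible p-prime e∣p
... | inj₁ e≡1 = e≡1
... | inj₂ refl = contradiction e∣d p∤d

coprime-∣ʳ : ∀ {a m n} → Coprime a n → m ∣ n → Coprime a m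
coprime-∣ʳ coprime m∣n (d∣a , d∣m) = coprime (d∣a , ∣-trans d∣m m∣n)

coprime-∣ˡ : ∀ {a m n} → Coprime n a → m ∣ n → Coprime m a
coprime-∣ˡ coprime m∣n = Coprime.sym (coprime-∣ʳ (Coprime.sym coprime) m∣n)

coprime-* : ∀ {m a b} → Coprime m a → Coprime m b → Coprime m (a * b)
coprime-* {m} {a} coprime-a coprime-b {d} (d∣m , d∣ab) =
  coprime-b (d∣m , coprime-divisor (Coprime.sym (coprime-∣ʳ (Coprime.sym coprime-a) d∣m)) d∣ab)

coprime-^ : ∀ {m a} k → Coprime m a → Coprime m (a ^ k)
coprime-^ zero    _       = Coprime.sym (1-coprimeTo _)
coprime-^ (suc k) coprime = coprime-* coprime (coprime-^ k coprime)

coprime⇒*∣ : ∀ {a b X} → Coprime a b → a ∣ X → b ∣ X → a * b ∣ X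
coprime⇒*∣ {a} {b} coprime a∣X b∣X = subst (_∣ _) lcm≡a*b (lcm-least a∣X b∣X)
  where
  lcm≡a*b : lcm a b ≡ a * b
  lcm≡a*b = trans (sym (*-identityˡ _)) (trans (cong (_* lcm a b) (sym (coprime⇒gcd≡1 coprime))) (gcd*lcm a b))

product-distinct-primes∣ : ∀ {ps X} → Unique ps → All Prime ps → (∀ {p} → p ∈ ps → p ∣ X) → product ps ∣ X
product-distinct-primes∣ {[]}     {X} _ _ _ = 1∣ X
product-distinct-primes∣ {p ∷ ps} (p∉ps ∷ unique) (p-prime ∷ primes) ∣X =
  coprime⇒*∣ (no-common-prime⇒coprime p-coprime) (∣X (here refl))
    (product-distinct-primes∣ unique primes (λ q∈ps → ∣X (there q∈ps)))
  where
  p-coprime : ∀ {q} → Prime q → q ∣ p → q ∣ product ps → ⊥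
  p-coprime q-prime q∣p q∣∏ with prime∣prime⇒≡ q-prime p-prime q∣p
  ... | refl = All.lookup p∉ps (factorisationHasAllPrimeFactors q-prime q∣∏ primes) refl

module _ {m : ℕ} where

  private
    P? = λ p → prime? p ×-dec (p ∣? m)

  rad∣ : ∀ {X} → (∀ {p} → Prime p → p ∣ m → p ∣ X) → rad m ∣ X
  rad∣ ∣X = product-distinct-primes∣ (Unique.filter⁺ P? (Unique.upTo⁺ (suc m)))
    (All.map proj₁ (all-filter P? (upTo (suc m))))
    (λ p∈ → let (_ , p-prime , p∣m) = ∈-filter⁻ P? {xs = upTo (suc m)} p∈ in ∣X p-prime p∣m)

  rad∣self : rad m ∣ m
  rad∣self = rad∣ (λ _ p∣m → p∣m)

  prime∣⇒∣rad : ∀ {p} .{{_ : NonZero m}} → Prime p → p ∣ m → p ∣ rad m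
  prime∣⇒∣rad p-prime p∣m = ∈⇒∣product (∈-filter⁺ P? (∈-upTo⁺ (s≤s (∣⇒≤ p∣m))) (p-prime , p∣m))

∃term-divisible : ∀ {p d} → Prime p → ¬ p ∣ d → ∀ w → ∃[ m ] p ∣ w + m * d
∃term-divisible {p@(suc p′)} {d} p-prime p∤d w with coprime-Bézout (Coprime.sym (prime∤⇒coprime p-prime p∤d))
... | Bézout.+- x y 1+yp≡xd = p′ * w * x , divides (w + p′ * w * y) (begin
  w + p′ * w * x * d        ≡⟨ cong (_+_ w) (*-assoc (p′ * w) x d) ⟩
  w + p′ * w * (x * d)      ≡⟨ cong (λ xd → w + p′ * w * xd) 1+yp≡xd ⟨
  w + p′ * w * (1 + y * p)  ≡⟨ regroup w p′ y ⟩
  (w + p′ * w * y) * p      ∎)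
  where
  open ≡-Reasoning
  regroup : ∀ w p′ y → w + p′ * w * (1 + y * (1 + p′)) ≡ (w + p′ * w * y) * (1 + p′)
  regroup = solve-∀
... | Bézout.-+ x y 1+xd≡yp = w * x , divides (w * y) (begin
  w + w * x * d        ≡⟨ regroup w x d ⟩
  w * (1 + x * d)      ≡⟨ cong (w *_) 1+xd≡yp ⟩
  w * (y * p)          ≡⟨ *-assoc w y p ⟨
  w * y * p            ∎)
  where
  open ≡-Reasoning
  regroup : ∀ w x d → w + w * x * d ≡ w * (1 + x * d)
  regroup = solve-∀


-- Geometric sums and lifting the exponent

geomSum : ℕ → ℕ → ℕ
geomSum Q zero    = 0
geomSum Q (suc k) = 1 + Q * geomSum Q k

suc^≡1+*geomSum : ∀ R k → suc R ^ k ≡ 1 + R * geomSum (suc R) k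
suc^≡1+*geomSum R zero    = cong suc (sym (*-zeroʳ R))
suc^≡1+*geomSum R (suc k) = trans (cong (suc R *_) (suc^≡1+*geomSum R k)) (expand R (geomSum (suc R) k))
  where
  expand : ∀ R s → (1 + R) * (1 + R * s) ≡ 1 + R * (1 + (1 + R) * s)
  expand = solve-∀

geomSum-+ : ∀ Q a b → geomSum Q (a + b) ≡ geomSum Q a + Q ^ a * geomSum Q b
geomSum-+ Q zero    b = sym (+-identityʳ (geomSum Q b))
geomSum-+ Q (suc a) b =
  trans (cong (λ s → 1 + Q * s) (geomSum-+ Q a b)) (expand Q (geomSum Q a) (Q ^ a) (geomSum Q b))
  where
  expand : ∀ Q x y z → 1 + Q * (x + y * z) ≡ 1 + Q * x + Q * y * z
  expand = solve-∀

geomSum-* : ∀ Q a b → geomSum Q (b * a) ≡ geomSum Q a * geomSum (Q ^ a) b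
geomSum-* Q a zero    = sym (*-zeroʳ (geomSum Q a))
geomSum-* Q a (suc b) =
  trans (geomSum-+ Q a (b * a)) (trans (cong (λ s → geomSum Q a + Q ^ a * s) (geomSum-* Q a b))
    (factor (geomSum Q a) (Q ^ a) (geomSum (Q ^ a) b)))
  where
  factor : ∀ x y z → x + y * (x * z) ≡ x * (1 + y * z)
  factor = solve-∀

suc≡1mod : ∀ R → suc R ≡ 1 mod R
suc≡1mod R = from (≡mod⇔∣∸ (s≤s z≤n)) ∣-refl

geomSum≡mod : ∀ R k → geomSum (suc R) k ≡ k mod R
geomSum≡mod R zero    = ≡mod-refl
geomSum≡mod R (suc k) = ≡mod-+ˡ 1 (subst (λ z → suc R * geomSum (suc R) k ≡ z mod R) (+-identityʳ k)
  (≡mod-* (suc≡1mod R) (geomSum≡mod R k)))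

triangle : ℕ → ℕ
triangle zero    = 0
triangle (suc k) = triangle k + k

geomSum≡mod² : ∀ R k → geomSum (suc R) k ≡ k + R * triangle k mod R * R
geomSum≡mod² R zero    = ≡mod-reflexive (sym (*-zeroʳ R))
geomSum≡mod² R (suc k) = begin
  1 + suc R * geomSum (suc R) k      ≈⟨ ≡mod-+ˡ 1 (≡mod-*ˡ (suc R) (geomSum≡mod² R k)) ⟩
  1 + suc R * (k + R * t)            ≡⟨ expand R k t ⟩
  suc k + R * (t + k) + t * (R * R)  ≈⟨ ≡mod-+-multiple _ t ⟩
  suc k + R * (t + k)                ∎
  where
  open ≡mod-Reasoning (R * R)
  t = triangle k
  expand : ∀ R k t → 1 + (1 + R) * (k + R * t) ≡ 1 + k + R * (t + k) + t * (R * R)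
  expand = solve-∀

triangle-odd : ∀ h → triangle (suc (h * 2)) ≡ suc (h * 2) * h
triangle-odd zero    = refl
triangle-odd (suc h) = trans (cong (λ s → s + suc (h * 2) + suc (suc (h * 2))) (triangle-odd h)) (expand h)
  where
  expand : ∀ h → (1 + h * 2) * h + (1 + h * 2) + (2 + h * 2) ≡ (3 + h * 2) * (1 + h)
  expand = solve-∀

p*p∣R*triangle : ∀ {p R} → Prime p → p ∣ R → (p ≡ 2 → 4 ∣ R) → p * p ∣ R * triangle p
p*p∣R*triangle {p} {R} p-prime p∣R p≡2⇒4∣R with p ≟ 2 | even⊎odd p
... | yes refl | _             = ∣m⇒∣m*n 1 (p≡2⇒4∣R refl)
... | no p≢2   | h , inj₁ p≡2h = contradiction (sym (prime∣prime⇒≡ prime[2] p-prime (divides h p≡2h))) p≢2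
... | no _     | h , inj₂ refl  = *-pres-∣ p∣R (divides h (trans (triangle-odd h) (*-comm _ h)))

geomSum-prime≡mod : ∀ {p R} → Prime p → p ∣ R → (p ≡ 2 → 4 ∣ R) → geomSum (suc R) p ≡ p mod p * p
geomSum-prime≡mod {p} {R} p-prime p∣R p≡2⇒4∣R = begin
  geomSum (suc R) p  ≈⟨ ≡mod-∣ (*-pres-∣ p∣R p∣R) (geomSum≡mod² R p) ⟩
  p + R * triangle p ≈⟨ ≡mod-+ˡ p (from ≡0mod⇔∣ (p*p∣R*triangle p-prime p∣R p≡2⇒4∣R)) ⟩
  p + 0              ≡⟨ +-identityʳ p ⟩
  p                  ∎
  where open ≡mod-Reasoning (p * p)

∣R⇒[∣geomSum⇔∣] : ∀ {d R k} → d ∣ R → d ∣ geomSum (suc R) k ⇔ d ∣ k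
∣R⇒[∣geomSum⇔∣] {d} {R} {k} d∣R = mk⇔
  (λ d∣S → to ≡0mod⇔∣ (≡mod-trans (≡mod-sym S≡k) (from ≡0mod⇔∣ d∣S)))
  (λ d∣k → to ≡0mod⇔∣ (≡mod-trans S≡k (from ≡0mod⇔∣ d∣k)))
  where
  S≡k : geomSum (suc R) k ≡ k mod d
  S≡k = ≡mod-∣ d∣R (geomSum≡mod R k)

LTECondition : ℕ → ℕ → Set
LTECondition τ R = (∀ {p} → Prime p → p ∣ τ → p ∣ R) × (4 ∣ τ → 4 ∣ R)

LTECondition-mono : ∀ {τ τ′ R R′} → τ′ ∣ τ → R ∣ R′ → LTECondition τ R → LTECondition τ′ R′
LTECondition-mono τ′∣τ R∣R′ (primes , four) =
  (λ p-prime p∣τ′ → ∣-trans (primes p-prime (∣-trans p∣τ′ τ′∣τ)) R∣R′) ,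
  (λ 4∣τ′ → ∣-trans (four (∣-trans 4∣τ′ τ′∣τ)) R∣R′)

-- A common prime factor of τ′ and V divides R, hence divides p ≡ geomSum (suc R) p (mod R); but
-- p² ∤ geomSum (suc R) p.
coprime-geomSum/p : ∀ {p τ′ R V} → Prime p → LTECondition (τ′ * p) R → geomSum (suc R) p ≡ V * p → Coprime τ′ V
coprime-geomSum/p {p} {τ′} {R} {V} p-prime (primes , four) S≡Vp = no-common-prime⇒coprime common
  where
  instance _ = prime⇒nonZero p-prime
  common : ∀ {ℓ} → Prime ℓ → ℓ ∣ τ′ → ℓ ∣ V → ⊥
  common {ℓ} ℓ-prime ℓ∣τ′ ℓ∣V
    with refl ← prime∣prime⇒≡ ℓ-prime p-prime
                  (to (∣R⇒[∣geomSum⇔∣] (primes ℓ-prime (∣m⇒∣m*n p ℓ∣τ′))) (subst (ℓ ∣_) (sym S≡Vp) (∣m⇒∣m*n p ℓ∣V)))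
    = <⇒≱ (m<m*n p p (prime>1 p-prime)) (∣⇒≤ p*p∣p)
    where
    p≡0 : p ≡ 0 mod p * p
    p≡0 = ≡mod-trans (≡mod-sym (geomSum-prime≡mod p-prime p∣R (λ { refl → four (*-monoˡ-∣ p ℓ∣τ′) })))
                     (from ≡0mod⇔∣ (subst (p * p ∣_) (sym S≡Vp) (*-monoˡ-∣ p ℓ∣V)))
      where
      p∣R = primes p-prime (n∣m*n τ′)
    p*p∣p : p * p ∣ p
    p*p∣p = to ≡0mod⇔∣ p≡0

∣geomSum⇒∣-step : ∀ {τ′ p R} → Prime p → LTECondition (τ′ * p) R →
                  (∀ {R′} → LTECondition τ′ R′ → ∀ k → τ′ ∣ geomSum (suc R′) k → τ′ ∣ k) →
                  ∀ k → τ′ * p ∣ geomSum (suc R) k → τ′ * p ∣ k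
∣geomSum⇒∣-step {τ′} {p} {R} p-prime cond ih k τ∣S =
  subst (τ′ * p ∣_) (sym k≡k′p) (*-monoˡ-∣ p (ih (LTECondition-mono (m∣m*n p) (m∣m*n Sₚ) cond) k′ τ′∣X))
  where
  instance _ = prime⇒nonZero p-prime
  Q = suc R
  Sₚ = geomSum Q p
  p∣R : p ∣ R
  p∣R = proj₁ cond p-prime (n∣m*n τ′)
  p∣k : p ∣ k
  p∣k = to (∣R⇒[∣geomSum⇔∣] p∣R) (∣-trans (n∣m*n τ′) τ∣S)
  p∣Sₚ : p ∣ Sₚ
  p∣Sₚ = from (∣R⇒[∣geomSum⇔∣] p∣R) ∣-refl
  k′ = quotient p∣k
  k≡k′p = equality p∣k
  V = quotient p∣Sₚ
  X = geomSum (suc (R * Sₚ)) k′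
  S-factor : geomSum Q k ≡ V * X * p
  S-factor = begin
    geomSum Q k                  ≡⟨ cong (geomSum Q) k≡k′p ⟩
    geomSum Q (k′ * p)           ≡⟨ geomSum-* Q p k′ ⟩
    Sₚ * geomSum (Q ^ p) k′      ≡⟨ cong₂ (λ s Qᵖ → s * geomSum Qᵖ k′) (equality p∣Sₚ) (suc^≡1+*geomSum R p) ⟩
    V * p * X                    ≡⟨ swap V p X ⟩
    V * X * p                    ∎
    where
    open ≡-Reasoning
    swap : ∀ a b c → a * b * c ≡ a * c * b
    swap = solve-∀
  τ′∣X : τ′ ∣ X
  τ′∣X = coprime-divisor (coprime-geomSum/p {V = V} p-prime cond (equality p∣Sₚ))
                         (*-cancelʳ-∣ {n = V * X} p (subst (τ′ * p ∣_) S-factor τ∣S))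

∣geomSum⇒∣ : ∀ τ {R} → LTECondition τ R → ∀ k → τ ∣ geomSum (suc R) k → τ ∣ k
∣geomSum⇒∣ = <-rec _ induct
  where
  induct : ∀ τ → (∀ {τ′} → τ′ < τ → ∀ {R} → LTECondition τ′ R → ∀ k → τ′ ∣ geomSum (suc R) k → τ′ ∣ k) →
           ∀ {R} → LTECondition τ R → ∀ k → τ ∣ geomSum (suc R) k → τ ∣ k
  induct zero       _ _ zero    _   = ∣-refl
  induct zero       _ _ (suc k) 0∣S = contradiction (0∣⇒≡0 0∣S) λ ()
  induct (suc zero) _ _ k       _   = 1∣ k
  induct τ@(suc (suc _)) rec {R} cond k τ∣S with p , p-prime , divides τ′ τ≡τ′p ← ∃prime∣ {τ} (λ ()) =
    subst (_∣ k) (sym τ≡τ′p) (∣geomSum⇒∣-step p-prime cond′ (rec τ′<τ) k τ′p∣S)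
    where
    cond′ = subst (λ t → LTECondition t R) τ≡τ′p cond
    τ′p∣S = subst (_∣ geomSum (suc R) k) τ≡τ′p τ∣S
    instance
      _ = m*n≢0⇒m≢0 τ′ {{subst NonZero τ≡τ′p _}}
    τ′<τ : τ′ < τ
    τ′<τ = subst (τ′ <_) (sym τ≡τ′p) (m<m*n τ′ p (prime>1 p-prime))

injective⇒surjective : ∀ {m} (f : Fin m → Fin m) → Injective _≡_ _≡_ f → ∀ y → ∃[ x ] f x ≡ y
injective⇒surjective {suc m} f f-injective y with any? (λ x → f x ≟ᶠ y)
... | yes hit = hit
... | no  miss = contradiction (λ {x} {x′} → g-injective {x} {x′}) (<⇒notInjective (n<1+n m))
  where
  g : Fin (suc m) → Fin m
  g x = punchOut {i = y} {j = f x} (λ y≡fx → miss (x , sym y≡fx))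
  g-injective : Injective _≡_ _≡_ g
  g-injective gx≡gx′ = f-injective (punchOut-injective {i = y} _ _ gx≡gx′)

residues-surjective : ∀ {m} .{{_ : NonZero m}} (h : ℕ → ℕ) →
                      (∀ i δ → i + suc δ < m → h i % m ≢ h (i + suc δ) % m) →
                      ∀ {k} → k < m → ∃[ i ] (i < m × h i % m ≡ k)
residues-surjective {m} h separated {k} k<m =
  let i , Fi≡k = injective⇒surjective F F-injective (fromℕ< k<m)
  in toℕ i , toℕ<n i , trans (sym (toℕF i)) (trans (cong toℕ Fi≡k) (toℕ-fromℕ< k<m))
  where
  F : Fin m → Fin m
  F i = fromℕ< (m%n<n (h (toℕ i)) m)
  toℕF : ∀ i → toℕ (F i) ≡ h (toℕ i) % m
  toℕF i = toℕ-fromℕ< (m%n<n (h (toℕ i)) m)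
  separated′ : ∀ {i j} → i < j → j < m → h i % m ≢ h j % m
  separated′ {i} {j} i<j j<m = subst (λ j → h i % m ≢ h j % m) j≡ (separated i _ (subst (_< m) (sym j≡) j<m))
    where
    j≡ = trans (+-suc i (j ∸ suc i)) (m+[n∸m]≡n i<j)
  F≡⇒%≡ : ∀ {i j} → F i ≡ F j → h (toℕ i) % m ≡ h (toℕ j) % m
  F≡⇒%≡ {i} {j} Fi≡Fj = trans (sym (toℕF i)) (trans (cong toℕ Fi≡Fj) (toℕF j))
  F-injective : Injective _≡_ _≡_ F
  F-injective {i} {j} Fi≡Fj with <-cmp (toℕ i) (toℕ j)
  ... | tri< i<j _ _ = contradiction (F≡⇒%≡ Fi≡Fj) (separated′ i<j (toℕ<n j))
  ... | tri≈ _ i≡j _ = toℕ-injective i≡j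
  ... | tri> _ _ j<i = contradiction (F≡⇒%≡ (sym Fi≡Fj)) (separated′ j<i (toℕ<n i))

LTECondition⇒coprime : ∀ {τ R} → LTECondition τ R → Coprime τ (suc R)
LTECondition⇒coprime (primes , _) = no-common-prime⇒coprime λ {p} p-prime p∣τ p∣1+R →
  prime≢1 p-prime (∣1⇒≡1 (∣m+n∣m⇒∣n (subst (p ∣_) (+-comm 1 _) p∣1+R) (primes p-prime p∣τ)))

geomSum-residues-surjective : ∀ {τ R a} .{{_ : NonZero τ}} → LTECondition τ R → Coprime τ a →
                              ∀ {k} → k < τ → ∃[ i ] (i < τ × (a * geomSum (suc R) i) % τ ≡ k)
geomSum-residues-surjective {τ} {R} {a} cond coprime = residues-surjective (λ i → a * geomSum (suc R) i) separated
  where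
  separated : ∀ i δ → i + suc δ < τ → (a * geomSum (suc R) i) % τ ≢ (a * geomSum (suc R) (i + suc δ)) % τ
  separated i δ lt eq = <⇒≱ (≤-<-trans (m≤n+m (suc δ) i) lt) (∣⇒≤ τ∣δ)
    where
    S = geomSum (suc R)
    X = a * suc R ^ i * S (suc δ)
    split : a * S (i + suc δ) ≡ a * S i + X
    split = trans (cong (a *_) (geomSum-+ (suc R) i (suc δ))) (distrib a (S i) (suc R ^ i) (S (suc δ)))
      where
      distrib : ∀ a x y z → a * (x + y * z) ≡ a * x + a * y * z
      distrib = solve-∀
    X≡0 : a * S i + X ≡ a * S i + 0 mod τ
    X≡0 = begin
      a * S i + X         ≡⟨ split ⟨
      a * S (i + suc δ)   ≈⟨ %≡%⇒≡mod eq ⟨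
      a * S i             ≡⟨ +-identityʳ (a * S i) ⟨
      a * S i + 0         ∎
      where open ≡mod-Reasoning τ
    τ∣δ : τ ∣ suc δ
    τ∣δ = ∣geomSum⇒∣ τ cond (suc δ) (coprime-divisor (coprime-* coprime (coprime-^ i (LTECondition⇒coprime cond)))
      (to ≡0mod⇔∣ (≡mod-+-cancelˡ (a * S i) X≡0)))


-- Multiplicative orders

module _ {m q o : ℕ} .{{_ : NonZero q}} (ord : IsOrd m q o) where

  private instance
    _ = >-nonZero (proj₁ ord)

  IsOrd⇒^≡1 : q ^ o ≡ 1 mod m
  IsOrd⇒^≡1 = from (≡mod⇔∣∸ (m^n>0 q o)) (proj₁ (proj₂ ord))

  IsOrd⇒^%≡1 : ∀ s → q ^ s ≡ 1 mod m → q ^ (s % o) ≡ 1 mod m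
  IsOrd⇒^%≡1 s q^s≡1 = begin
    q ^ (s % o)                    ≡⟨ *-identityʳ _ ⟨
    q ^ (s % o) * 1                ≈⟨ ≡mod-*ˡ (q ^ (s % o)) (^≡1⇒^*≡1 (s / o) IsOrd⇒^≡1) ⟨
    q ^ (s % o) * q ^ (s / o * o)  ≡⟨ ^-distribˡ-+-* q (s % o) _ ⟨
    q ^ (s % o + s / o * o)        ≡⟨ cong (q ^_) (m≡m%n+[m/n]*n s o) ⟨
    q ^ s                          ≈⟨ q^s≡1 ⟩
    1                              ∎
    where open ≡mod-Reasoning m

  IsOrd⇒∣ : ∀ s → q ^ (s % o) ≡ 1 mod m → o ∣ s
  IsOrd⇒∣ s q^[s%o]≡1 with s % o in s%o≡r
  ... | zero  = m%n≡0⇒n∣m s o s%o≡r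
  ... | suc r = contradiction (proj₂ (proj₂ ord) (suc r) (s≤s z≤n) (to (≡mod⇔∣∸ (m^n>0 q (suc r))) q^[s%o]≡1))
                              (<⇒≱ (subst (_< o) s%o≡r (m%n<n s o)))

  IsOrd⇒[^≡1⇔∣] : ∀ s → q ^ s ≡ 1 mod m ⇔ o ∣ s
  IsOrd⇒[^≡1⇔∣] s = mk⇔ (λ q^s≡1 → IsOrd⇒∣ s (IsOrd⇒^%≡1 s q^s≡1)) λ { (divides t refl) → ^≡1⇒^*≡1 t IsOrd⇒^≡1 }

module _ {m q ω : ℕ} .{{_ : NonZero ω}} (coprime : Coprime m q) (order : ∀ s → q ^ s ≡ 1 mod m ⇔ ω ∣ s) where

  ≤∧^≡^⇒%≡% : ∀ {a c} → a ≤ c → q ^ c ≡ q ^ a mod m → c % ω ≡ a % ω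
  ≤∧^≡^⇒%≡% {a} {c} a≤c q^c≡q^a = trans (cong (_% ω) (sym a+s≡c)) (%-remove-+ʳ a (to (order s) q^s≡1))
    where
    s = c ∸ a
    a+s≡c = m+[n∸m]≡n a≤c
    q^a*q^s≡q^a*1 : q ^ a * q ^ s ≡ q ^ a * 1 mod m
    q^a*q^s≡q^a*1 = begin
      q ^ a * q ^ s  ≡⟨ ^-distribˡ-+-* q a s ⟨
      q ^ (a + s)    ≡⟨ cong (q ^_) a+s≡c ⟩
      q ^ c          ≈⟨ q^c≡q^a ⟩
      q ^ a          ≡⟨ *-identityʳ (q ^ a) ⟨
      q ^ a * 1      ∎
      where open ≡mod-Reasoning m
    q^s≡1 : q ^ s ≡ 1 mod m
    q^s≡1 = ≡mod-*-cancelˡ (coprime-^ a coprime) q^a*q^s≡q^a*1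

  ^≡^⇒%≡% : ∀ {c a} → q ^ c ≡ q ^ a mod m → c % ω ≡ a % ω
  ^≡^⇒%≡% {c} {a} q^c≡q^a with ≤-total a c
  ... | inj₁ a≤c = ≤∧^≡^⇒%≡% a≤c q^c≡q^a
  ... | inj₂ c≤a = sym (≤∧^≡^⇒%≡% c≤a (≡mod-sym q^c≡q^a))

ρ : ℕ → ℕ
ρ N with 8 ∣? N
... | yes _ = lcm (rad N) 4
... | no  _ = rad N

≡mod-ρ⇔ : ∀ N {x y} → x ≡ y mod ρ N ⇔ (x ≡ y mod rad N × (8 ∣ N → x ≡ y mod 4))
≡mod-ρ⇔ N with 8 ∣? N
... | yes 8∣N = mk⇔ (λ x≡y → ≡mod-∣ (m∣lcm[m,n] (rad N) 4) x≡y , λ _ → ≡mod-∣ (n∣lcm[m,n] (rad N) 4) x≡y)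
                    (λ (x≡y , x≡y[4]) → ≡mod-lcm x≡y (x≡y[4] 8∣N))
... | no  8∤N = mk⇔ (λ x≡y → x≡y , λ 8∣N → contradiction 8∣N 8∤N) proj₁

ρ∣⇔ : ∀ N {X} → ρ N ∣ X ⇔ (rad N ∣ X × (8 ∣ N → 4 ∣ X))
ρ∣⇔ N with 8 ∣? N
... | yes 8∣N = mk⇔ (λ ρ∣X → ∣-trans (m∣lcm[m,n] (rad N) 4) ρ∣X , λ _ → ∣-trans (n∣lcm[m,n] (rad N) 4) ρ∣X)
                    (λ (rad∣X , 4∣X) → lcm-least rad∣X (4∣X 8∣N))
... | no  8∤N = mk⇔ (λ rad∣X → rad∣X , λ 8∣N → contradiction 8∣N 8∤N) proj₁

module _ {q N o : ℕ} .{{_ : NonZero q}} (coprime : Coprime q N) (ord : IsOrd (rad N) q o) where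

  private
    instance _ = >-nonZero (proj₁ ord)
    qᵒ = q ^ o
    q^[t*o]≡qᵒ^t : ∀ t → q ^ (t * o) ≡ qᵒ ^ t
    q^[t*o]≡qᵒ^t t = trans (cong (q ^_) (*-comm t o)) (sym (^-*-assoc q o t))
    order-rad = IsOrd⇒[^≡1⇔∣] ord

  ^≡1⇔o∣ : (∀ t → 8 ∣ N → qᵒ ^ t ≡ 1 mod 4) →
           ∀ s → (q ^ s ≡ 1 mod rad N × (8 ∣ N → q ^ s ≡ 1 mod 4)) ⇔ o ∣ s
  ^≡1⇔o∣ qᵒ^t≡1 s = mk⇔ (λ (q^s≡1 , _) → to (order-rad s) q^s≡1) λ where
    o∣s@(divides t refl) → from (order-rad s) o∣s , λ 8∣N → subst (_≡ 1 mod 4) (sym (q^[t*o]≡qᵒ^t t)) (qᵒ^t≡1 t 8∣N)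

  ^≡1⇔2o∣ : qᵒ % 4 ≡ 3 → 8 ∣ N →
            ∀ s → (q ^ s ≡ 1 mod rad N × (8 ∣ N → q ^ s ≡ 1 mod 4)) ⇔ 2 * o ∣ s
  ^≡1⇔2o∣ qᵒ%4≡3 8∣N s = mk⇔ doubled undoubled
    where
    qᵒ^t≡1⇔2∣t = ≡3mod4⇒[^≡1⇔2∣] (%≡%⇒≡mod {x = qᵒ} {y = 3} qᵒ%4≡3)
    doubled : (q ^ s ≡ 1 mod rad N × (8 ∣ N → q ^ s ≡ 1 mod 4)) → 2 * o ∣ s
    doubled (q^s≡1 , q^s≡1[4]) = double (to (order-rad s) q^s≡1)
      where
      double : o ∣ s → 2 * o ∣ s
      double (divides t s≡to) = subst (2 * o ∣_) (sym s≡to) (*-monoˡ-∣ o (to (qᵒ^t≡1⇔2∣t t)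
        (subst (_≡ 1 mod 4) (trans (cong (q ^_) s≡to) (q^[t*o]≡qᵒ^t t)) (q^s≡1[4] 8∣N))))
    undoubled : 2 * o ∣ s → (q ^ s ≡ 1 mod rad N × (8 ∣ N → q ^ s ≡ 1 mod 4))
    undoubled (divides k s≡k*2o) = from (order-rad s) (divides (k * 2) s≡2k*o) , λ _ →
      subst (_≡ 1 mod 4) (sym (trans (cong (q ^_) s≡2k*o) (q^[t*o]≡qᵒ^t (k * 2))))
        (from (qᵒ^t≡1⇔2∣t (k * 2)) (divides k refl))
      where
      s≡2k*o = trans s≡k*2o (sym (*-assoc k 2 o))

  ^≡1⇔o∣-unless-3mod4 : qᵒ % 4 ≢ 3 → ∀ s → (q ^ s ≡ 1 mod rad N × (8 ∣ N → q ^ s ≡ 1 mod 4)) ⇔ o ∣ s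
  ^≡1⇔o∣-unless-3mod4 qᵒ≢3 = ^≡1⇔o∣ λ t 8∣N →
    ≡1⇒^≡1 t (odd∧≢3mod4⇒≡1 (coprime∧8∣⇒odd (Coprime.sym (coprime-^ o (Coprime.sym coprime))) 8∣N) qᵒ≢3)

private
  omega-order′ : ∀ n γ .{{_ : NonZero n}} {q o} .{{_ : NonZero q}} → Coprime q (nγ n γ) → IsOrd (rad (nγ n γ)) q o →
                 ∀ s → (q ^ s ≡ 1 mod rad (nγ n γ) × (8 ∣ nγ n γ → q ^ s ≡ 1 mod 4)) ⇔ omega n γ q o ∣ s
  omega-order′ n γ {q} {o} coprime ord with (q ^ o) % 4 ≟ 3 | 8 ∣? nγ n γ
  ... | yes qᵒ≡3 | yes 8∣N = ^≡1⇔2o∣ coprime ord qᵒ≡3 8∣N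
  ... | yes _    | no  8∤N = ^≡1⇔o∣ coprime ord λ _ 8∣N → contradiction 8∣N 8∤N
  ... | no  qᵒ≢3 | _       = ^≡1⇔o∣-unless-3mod4 coprime ord qᵒ≢3

omega-order : ∀ n γ .{{_ : NonZero n}} {q o} .{{_ : NonZero q}} → Coprime q (nγ n γ) → IsOrd (rad (nγ n γ)) q o →
              ∀ s → q ^ s ≡ 1 mod ρ (nγ n γ) ⇔ omega n γ q o ∣ s
omega-order n γ coprime ord s = ⇔.trans (≡mod-ρ⇔ (nγ n γ)) (omega-order′ n γ coprime ord s)

omega-nonZero : ∀ n γ .{{_ : NonZero n}} q {o} → 0 < o → NonZero (omega n γ q o)
omega-nonZero n γ q {o} o>0 with (q ^ o) % 4 ≟ 3 | 8 ∣? nγ n γ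
... | yes _ | yes _ = m*n≢0 2 o {{_}} {{>-nonZero o>0}}
... | yes _ | no  _ = >-nonZero o>0
... | no  _ | _     = >-nonZero o>0


-- Decompositions

Disjoint : ∀ {k} → (Fin k → Subset) → Set
Disjoint B = ∀ i j → i ≢ j → ∀ x → B i x → ¬ B j x

Covers : ∀ {k} → (Fin k → Subset) → Subset → Set
Covers B C = ∀ x → C x ⇔ (∃[ i ] B i x)

IsEqualDiff⇒Satisfiable : ∀ {n} .{{_ : NonZero n}} {E} → IsEqualDiff n E → Satisfiable E
IsEqualDiff⇒Satisfiable (_ , _ , _ , e , e∈E , _) = e , e∈E

Disjoint⇒≡ : ∀ {k} {B : Fin k → Subset} → Disjoint B → ∀ {i j x} → B i x → B j x → i ≡ j
Disjoint⇒≡ disjoint {i} {j} {x} x∈Bᵢ x∈Bⱼ with i ≟ᶠ j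
... | yes i≡j = i≡j
... | no  i≢j = contradiction x∈Bⱼ (disjoint i j i≢j x x∈Bᵢ)

refines⇒Coarser : ∀ {C ω k} {B : Fin ω → Subset} {E : Fin k → Subset} → Disjoint B → Covers B C → Covers E C →
                  (f : Fin k → Fin ω) → (∀ i {x} → E i x → B (f i) x) → Coarser ω B k E
refines⇒Coarser {B = B} {E} disjoint B-covers E-covers f Eᵢ⊆B[fᵢ] = f , λ j x → mk⇔ (gather j x) (scatter j x)
  where
  gather : ∀ j x → B j x → ∃[ i ] (f i ≡ j × E i x)
  gather j x x∈Bⱼ =
    let i , x∈Eᵢ = to (E-covers x) (from (B-covers x) (j , x∈Bⱼ))
    in i , Disjoint⇒≡ disjoint (Eᵢ⊆B[fᵢ] i x∈Eᵢ) x∈Bⱼ , x∈Eᵢ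
  scatter : ∀ j x → ∃[ i ] (f i ≡ j × E i x) → B j x
  scatter j x (i , refl , x∈Eᵢ) = Eᵢ⊆B[fᵢ] i x∈Eᵢ

mutually-Coarser⇒SameBlocks : ∀ {ω k} {B : Fin ω → Subset} {E : Fin k → Subset} → Disjoint B →
                              (∀ j → Satisfiable (B j)) → (∀ i → Satisfiable (E i)) →
                              Coarser k E ω B → Coarser ω B k E → SameBlocks k E ω B
mutually-Coarser⇒SameBlocks {B = B} {E} disjoint B-nonempty E-nonempty (F , E≐⋃B) (G , B≐⋃E) =
  (λ i → G i , λ x → mk⇔ (E⊆B[G] i) (λ x∈B → from (E≐⋃B i x) (G i , FG i , x∈B))) ,
  (λ j → F j , λ x → mk⇔ (B⊆E[F] j) (λ x∈E → subst (λ j → B j x) (GF j) (E⊆B[G] (F j) x∈E)))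
  where
  E⊆B[G] : ∀ i {x} → E i x → B (G i) x
  E⊆B[G] i x∈Eᵢ = from (B≐⋃E (G i) _) (i , refl , x∈Eᵢ)
  B⊆E[F] : ∀ j {x} → B j x → E (F j) x
  B⊆E[F] j x∈Bⱼ = from (E≐⋃B (F j) _) (j , refl , x∈Bⱼ)
  FG : ∀ i → F (G i) ≡ i
  FG i = let e , e∈Eᵢ = E-nonempty i
             j , Fj≡i , e∈Bⱼ = to (E≐⋃B i e) e∈Eᵢ
         in trans (cong F (Disjoint⇒≡ disjoint (E⊆B[G] i e∈Eᵢ) e∈Bⱼ)) Fj≡i
  GF : ∀ j → G (F j) ≡ j
  GF j = let b , b∈Bⱼ = B-nonempty j in Disjoint⇒≡ disjoint (E⊆B[G] (F j) (B⊆E[F] j b∈Bⱼ)) b∈Bⱼ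

coarsest⇒SameBlocks : ∀ {n} .{{_ : NonZero n}} {C ω} {B : Fin ω → Subset} → IsEDDecomp n C ω B →
                      (∀ k (E : Fin k → Subset) → IsEDDecomp n C k E → Coarser ω B k E) →
                      ∀ k (E : Fin k → Subset) → IsEDDecomp n C k E →
                      (∀ k′ (E′ : Fin k′ → Subset) → IsEDDecomp n C k′ E′ → Coarser k E k′ E′) →
                      SameBlocks k E ω B
coarsest⇒SameBlocks B-decomp@(B-equalDiff , B-disjoint , _) B-coarsest k E E-decomp@(E-equalDiff , _) E-coarsest =
  mutually-Coarser⇒SameBlocks B-disjoint
    (λ j → IsEqualDiff⇒Satisfiable (B-equalDiff j)) (λ i → IsEqualDiff⇒Satisfiable (E-equalDiff i))
    (E-coarsest _ _ B-decomp) (B-coarsest k E E-decomp)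


-- Cyclotomic cosets

≡*⇒nonZeroʳ : ∀ {n d τ} .{{_ : NonZero n}} → n ≡ d * τ → NonZero τ
≡*⇒nonZeroʳ {n} {d} n≡dτ = ≢-nonZero λ τ≡0 → ≢-nonZero⁻¹ n (trans n≡dτ (trans (cong (d *_) τ≡0) (*-zeroʳ d)))

≡*⇒nonZeroˡ : ∀ {n d τ} .{{_ : NonZero n}} → n ≡ d * τ → NonZero d
≡*⇒nonZeroˡ {d = d} {τ} n≡dτ = ≡*⇒nonZeroʳ {d = τ} (trans n≡dτ (*-comm d τ))

-- β (1 + R)^i = β + d · a · geomSum (1 + R) i, and i ↦ a · geomSum (1 + R) i permutes the residues
-- modulo τ.
orbit-IsEqualDiff : ∀ {n τ d β R a} .{{_ : NonZero n}} → n ≡ d * τ → β * R ≡ d * a → Coprime τ a →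
                    LTECondition τ R → IsEqualDiff n (cyc n (suc R) β)
orbit-IsEqualDiff {n} {τ} {d} {β} {R} {a} n≡dτ βR≡da coprime cond =
  τ , d , n≡dτ , β % n , (0 , cong (_% n) (sym (*-identityʳ β))) , λ x → mk⇔ (orbit⊆ x) (⊆orbit x)
  where
  instance _ = ≡*⇒nonZeroʳ {d = d} n≡dτ
  S = geomSum (suc R)
  element : ∀ i → (β * suc R ^ i) % n ≡ (β % n + ((a * S i) % τ) * d) % n
  element i = ≡mod⇒%≡% (begin
    β * suc R ^ i              ≡⟨ cong (β *_) (suc^≡1+*geomSum R i) ⟩
    β * (1 + R * S i)          ≡⟨ expand β R (S i) ⟩
    β + β * R * S i            ≡⟨ cong (λ βR → β + βR * S i) βR≡da ⟩
    β + d * a * S i            ≡⟨ cong (_+_ β) (rotate d a (S i)) ⟩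
    β + (a * S i) * d          ≈⟨ ≡mod-+ (≡mod-sym (%≡mod β)) (*≡%*mod (a * S i) d n≡dτ) ⟩
    β % n + ((a * S i) % τ) * d ∎)
    where
    open ≡mod-Reasoning n
    expand : ∀ β R s → β * (1 + R * s) ≡ β + β * R * s
    expand = solve-∀
    rotate : ∀ d a s → d * a * s ≡ a * s * d
    rotate = solve-∀
  orbit⊆ : ∀ x → cyc n (suc R) β x → ∃[ k ] (k < τ × x ≡ (β % n + k * d) % n)
  orbit⊆ x (i , x≡) = (a * S i) % τ , m%n<n (a * S i) τ , trans x≡ (element i)
  ⊆orbit : ∀ x → ∃[ k ] (k < τ × x ≡ (β % n + k * d) % n) → cyc n (suc R) β x
  ⊆orbit x (k , k<τ , x≡) =
    let i , _ , aSᵢ≡k = geomSum-residues-surjective cond coprime k<τ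
    in i , trans x≡ (sym (trans (element i) (cong (λ k → (β % n + k * d) % n) aSᵢ≡k)))

equalDiff-closed : ∀ {n τ d e} .{{_ : NonZero n}} {E : Subset} → n ≡ d * τ →
                   (∀ x → E x ⇔ (∃[ k ] (k < τ × x ≡ (e + k * d) % n))) → ∀ m → E ((e + m * d) % n)
equalDiff-closed {n} {τ} {d} {e} n≡dτ char m =
  from (char _) (m % τ , m%n<n m τ , ≡mod⇒%≡% (≡mod-+ˡ e (*≡%*mod m d n≡dτ)))
  where
  instance _ = ≡*⇒nonZeroʳ {d = d} n≡dτ

pigeonhole₃ : ∀ {m a b x y z} → x ≡ a mod m ⊎ x ≡ b mod m → y ≡ a mod m ⊎ y ≡ b mod m → z ≡ a mod m ⊎ z ≡ b mod m →
              x ≡ y mod m ⊎ y ≡ z mod m ⊎ x ≡ z mod m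
pigeonhole₃ (inj₁ x≡a) (inj₁ y≡a) _          = inj₁ (≡mod-trans x≡a (≡mod-sym y≡a))
pigeonhole₃ (inj₂ x≡b) (inj₂ y≡b) _          = inj₁ (≡mod-trans x≡b (≡mod-sym y≡b))
pigeonhole₃ _          (inj₁ y≡a) (inj₁ z≡a) = inj₂ (inj₁ (≡mod-trans y≡a (≡mod-sym z≡a)))
pigeonhole₃ _          (inj₂ y≡b) (inj₂ z≡b) = inj₂ (inj₁ (≡mod-trans y≡b (≡mod-sym z≡b)))
pigeonhole₃ (inj₁ x≡a) (inj₂ _)   (inj₁ z≡a) = inj₂ (inj₂ (≡mod-trans x≡a (≡mod-sym z≡a)))
pigeonhole₃ (inj₂ x≡b) (inj₁ _)   (inj₂ z≡b) = inj₂ (inj₂ (≡mod-trans x≡b (≡mod-sym z≡b)))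

module _ {N γ′ q w d′ : ℕ} .{{_ : NonZero N}} (γ′-coprime : Coprime N γ′) (q-coprime : Coprime N q)
         (terms : ∀ m → ∃[ c ] (w + m * d′ ≡ γ′ * q ^ c mod N)) where

  private
    term-coprime : ∀ c → Coprime N (γ′ * q ^ c)
    term-coprime c = coprime-* γ′-coprime (coprime-^ c q-coprime)

  prime∣⇒∣step : ∀ {p} → Prime p → p ∣ N → p ∣ d′
  prime∣⇒∣step {p} p-prime p∣N with p ∣? d′
  ... | yes p∣d′ = p∣d′
  ... | no  p∤d′ =
    let m , p∣term = ∃term-divisible p-prime p∤d′ w
        c , term≡  = terms m
        p∣γ′qᶜ    = to ≡0mod⇔∣ (≡mod-trans (≡mod-sym (≡mod-∣ p∣N term≡)) (from ≡0mod⇔∣ p∣term))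
    in contradiction (term-coprime c (p∣N , p∣γ′qᶜ)) (prime≢1 p-prime)

  -- Modulo 8 the powers of the odd number q take only the values 1 and q, so two of the first
  -- three terms agree modulo 8.
  8∣⇒4∣step : 8 ∣ N → 4 ∣ d′
  8∣⇒4∣step 8∣N = two-agree⇒4∣ (pigeonhole₃ (class 0) (class 1) (class 2))
    where
    class : ∀ m → w + m * d′ ≡ γ′ * 1 mod 8 ⊎ w + m * d′ ≡ γ′ * q mod 8
    class m = let c , term≡ = terms m in
      Sum.map (λ qᶜ≡1 → ≡mod-trans (≡mod-∣ 8∣N term≡) (≡mod-*ˡ γ′ qᶜ≡1))
              (λ qᶜ≡q → ≡mod-trans (≡mod-∣ 8∣N term≡) (≡mod-*ˡ γ′ qᶜ≡q))
              (odd^≡1∨self (coprime∧8∣⇒odd (Coprime.sym q-coprime) 8∣N) c)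
    agree⇒8∣ : ∀ i δ → w + i * d′ ≡ w + (i + δ) * d′ mod 8 → 8 ∣ δ * d′
    agree⇒8∣ i δ tᵢ≡tⱼ = to ≡0mod⇔∣ (≡mod-+-cancelˡ (w + i * d′) (begin
      w + i * d′ + δ * d′   ≡⟨ regroup w i δ d′ ⟩
      w + (i + δ) * d′      ≈⟨ tᵢ≡tⱼ ⟨
      w + i * d′            ≡⟨ +-identityʳ _ ⟨
      w + i * d′ + 0        ∎))
      where
      open ≡mod-Reasoning 8
      regroup : ∀ w i δ d → w + i * d + δ * d ≡ w + (i + δ) * d
      regroup = solve-∀
    two-agree⇒4∣ : w + 0 * d′ ≡ w + 1 * d′ mod 8 ⊎ w + 1 * d′ ≡ w + 2 * d′ mod 8 ⊎ w + 0 * d′ ≡ w + 2 * d′ mod 8 →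
                   4 ∣ d′
    two-agree⇒4∣ (inj₁ t₀≡t₁)        = ∣-trans (divides 2 refl) (subst (8 ∣_) (*-identityˡ d′) (agree⇒8∣ 0 1 t₀≡t₁))
    two-agree⇒4∣ (inj₂ (inj₁ t₁≡t₂)) = ∣-trans (divides 2 refl) (subst (8 ∣_) (*-identityˡ d′) (agree⇒8∣ 1 1 t₁≡t₂))
    two-agree⇒4∣ (inj₂ (inj₂ t₀≡t₂)) = *-cancelˡ-∣ 2 (agree⇒8∣ 0 2 t₀≡t₂)

  ρ∣step : ρ N ∣ d′
  ρ∣step = from (ρ∣⇔ N) (rad∣ prime∣⇒∣step , 8∣⇒4∣step)

LTECondition-cofactor : ∀ {N R τ} .{{_ : NonZero N}} → N ≡ gcd R N * τ → rad N ∣ R → (8 ∣ N → 4 ∣ R) →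
                        LTECondition τ R
LTECondition-cofactor {N} {R} {τ} N≡Dτ rad∣R 8∣⇒4∣R = primes , four
  where
  τ∣N : τ ∣ N
  τ∣N = divides (gcd R N) N≡Dτ
  primes : ∀ {p} → Prime p → p ∣ τ → p ∣ R
  primes p-prime p∣τ = ∣-trans (prime∣⇒∣rad p-prime (∣-trans p∣τ τ∣N)) rad∣R
  four : 4 ∣ τ → 4 ∣ R
  four 4∣τ = 8∣⇒4∣R (subst (8 ∣_) (sym N≡Dτ) (*-pres-∣ 2∣D 4∣τ))
    where
    2∣τ = ∣-trans (divides 2 refl) 4∣τ
    2∣D = gcd-greatest (primes prime[2] 2∣τ) (∣-trans 2∣τ τ∣N)

module CyclotomicCoset {n q γ g N γ′ : ℕ} .{{_ : NonZero n}} .{{_ : NonZero q}}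
             (n≡gN : n ≡ g * N) (γ≡gγ′ : γ ≡ g * γ′) (γ′-coprime : Coprime N γ′) (q-coprime : Coprime N q)
             {ω : ℕ} .{{_ : NonZero ω}} (order : ∀ s → q ^ s ≡ 1 mod ρ N ⇔ ω ∣ s) where

  private instance
    g≢0 = ≡*⇒nonZeroˡ {d = g} n≡gN
    N≢0 = ≡*⇒nonZeroʳ {d = g} n≡gN

  C : Subset
  C = cyc n q γ

  B : Fin ω → Subset
  B = blocks n γ q ω

  ρ∣N : ρ N ∣ N
  ρ∣N = from (ρ∣⇔ N) (rad∣self , ∣-trans (divides 2 refl))

  exponents-mod-ρ : ∀ {c a} → q ^ c ≡ q ^ a mod ρ N → c % ω ≡ a % ω
  exponents-mod-ρ = ^≡^⇒%≡% (coprime-∣ˡ q-coprime ρ∣N) order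

  g*γ′ : ∀ x → γ * x ≡ g * (γ′ * x)
  g*γ′ x = trans (cong (_* x) γ≡gγ′) (*-assoc g γ′ x)

  ÷g : ∀ {x y} → g * x ≡ g * y mod n → x ≡ y mod N
  ÷g {x} {y} gx≡gy = ≡mod-*-cancelˡ-modulus {g = g} (subst (g * x ≡ g * y mod_) n≡gN gx≡gy)

  exponents-mod-n : ∀ {c a} → γ * q ^ c ≡ γ * q ^ a mod n → c % ω ≡ a % ω
  exponents-mod-n {c} {a} γqᶜ≡γqᵃ = exponents-mod-ρ (≡mod-∣ ρ∣N (≡mod-*-cancelˡ γ′-coprime
    (÷g (subst₂ (λ x y → x ≡ y mod n) (g*γ′ (q ^ c)) (g*γ′ (q ^ a)) γqᶜ≡γqᵃ))))

  blockOf : ℕ → Fin ω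
  blockOf c = fromℕ< (m%n<n c ω)

  blockOf-cong : ∀ {c a} → c % ω ≡ a % ω → blockOf c ≡ blockOf a
  blockOf-cong {c} {a} c%ω≡a%ω = fromℕ<-cong (c % ω) (a % ω) c%ω≡a%ω (m%n<n c ω) (m%n<n a ω)

  block-exponent : ∀ (j : Fin ω) i → γ * q ^ toℕ j * (q ^ ω) ^ i ≡ γ * q ^ (toℕ j + i * ω)
  block-exponent j i = begin
    γ * q ^ toℕ j * (q ^ ω) ^ i      ≡⟨ *-assoc γ _ _ ⟩
    γ * (q ^ toℕ j * (q ^ ω) ^ i)    ≡⟨ cong (λ x → γ * (q ^ toℕ j * x)) (^-*-assoc q ω i) ⟩
    γ * (q ^ toℕ j * q ^ (ω * i))    ≡⟨ cong (λ e → γ * (q ^ toℕ j * q ^ e)) (*-comm ω i) ⟩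
    γ * (q ^ toℕ j * q ^ (i * ω))    ≡⟨ cong (γ *_) (^-distribˡ-+-* q (toℕ j) (i * ω)) ⟨
    γ * q ^ (toℕ j + i * ω)          ∎
    where open ≡-Reasoning

  ∈B⇒ : ∀ {j x} → B j x → ∃[ c ] (x ≡ (γ * q ^ c) % n × c % ω ≡ toℕ j)
  ∈B⇒ {j} (i , x≡) =
    toℕ j + i * ω ,
    trans x≡ (cong (_% n) (block-exponent j i)) ,
    trans ([m+kn]%n≡m%n (toℕ j) i ω) (m<n⇒m%n≡m (toℕ<n j))

  ⇒∈B : ∀ {c x} → x ≡ (γ * q ^ c) % n → B (blockOf c) x
  ⇒∈B {c} x≡ = c / ω , trans x≡ (cong (_% n) (trans (cong (λ e → γ * q ^ e) c≡) (sym (block-exponent j (c / ω)))))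
    where
    j = blockOf c
    c≡ : c ≡ toℕ j + c / ω * ω
    c≡ = trans (m≡m%n+[m/n]*n c ω) (cong (_+ c / ω * ω) (sym (toℕ-fromℕ< (m%n<n c ω))))

  blocks-Covers : Covers B C
  blocks-Covers x = mk⇔ (λ (c , x≡) → blockOf c , ⇒∈B x≡)
                        (λ (j , x∈Bⱼ) → let c , x≡ , _ = ∈B⇒ {j} x∈Bⱼ in c , x≡)

  blocks-Disjoint : Disjoint B
  blocks-Disjoint i j i≢j x x∈Bᵢ x∈Bⱼ =
    let c  , x≡  , c%ω≡i  = ∈B⇒ x∈Bᵢ
        c′ , x≡′ , c′%ω≡j = ∈B⇒ x∈Bⱼ
    in i≢j (toℕ-injective (trans (sym c%ω≡i) (trans (exponents-mod-n (%≡%⇒≡mod (trans (sym x≡) x≡′))) c′%ω≡j)))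

  blocks-IsEqualDiff : ∀ j → IsEqualDiff n (B j)
  blocks-IsEqualDiff j = subst (λ Q → IsEqualDiff n (cyc n Q (γ * qʲ))) 1+R≡qᵚ
    (orbit-IsEqualDiff {d = g * D} {β = γ * qʲ} n≡gDτ γqʲR≡gD*a a-coprime (LTECondition-cofactor N≡Dτ rad∣R 8∣⇒4∣R))
    where
    qʲ = q ^ toℕ j
    R = q ^ ω ∸ 1
    1+R≡qᵚ : suc R ≡ q ^ ω
    1+R≡qᵚ = m+[n∸m]≡n (m^n>0 q ω)
    D = gcd R N
    instance _ = ≢-nonZero (gcd[m,n]≢0 R N (inj₂ (≢-nonZero⁻¹ N)))
    τ = N / D
    u = R / D
    N≡Dτ : N ≡ D * τ
    N≡Dτ = sym (m*[n/m]≡n (gcd[m,n]∣n R N))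
    n≡gDτ : n ≡ g * D * τ
    n≡gDτ = trans n≡gN (trans (cong (g *_) N≡Dτ) (sym (*-assoc g D τ)))
    γqʲR≡gD*a : γ * qʲ * R ≡ g * D * (γ′ * qʲ * u)
    γqʲR≡gD*a = trans (cong₂ (λ γ R → γ * qʲ * R) γ≡gγ′ (sym (m*[n/m]≡n (gcd[m,n]∣m R N)))) (regroup g γ′ qʲ D u)
      where
      regroup : ∀ g γ′ qʲ D u → g * γ′ * qʲ * (D * u) ≡ g * D * (γ′ * qʲ * u)
      regroup = solve-∀
    τ∣N : τ ∣ N
    τ∣N = divides D N≡Dτ
    a-coprime : Coprime τ (γ′ * qʲ * u)
    a-coprime = coprime-* (coprime-* (coprime-∣ˡ γ′-coprime τ∣N) (coprime-^ (toℕ j) (coprime-∣ˡ q-coprime τ∣N)))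
                          (Coprime.sym (coprime-/gcd R N))
    ρ∣R : ρ N ∣ R
    ρ∣R = to (≡mod⇔∣∸ (m^n>0 q ω)) (from (order ω) ∣-refl)
    rad∣R = proj₁ (to (ρ∣⇔ N) ρ∣R)
    8∣⇒4∣R = proj₂ (to (ρ∣⇔ N) ρ∣R)

  blocks-IsEDDecomp : IsEDDecomp n C ω B
  blocks-IsEDDecomp = blocks-IsEqualDiff , blocks-Disjoint , blocks-Covers

  -- Dividing out g turns an equal-difference subset of C into a progression of units modulo N,
  -- whose step is then divisible by ρ N.
  IsEqualDiff⇒exponents-agree : ∀ {E} → IsEqualDiff n E → (∀ {x} → E x → C x) →
                                ∃[ a ] (∀ {x c} → E x → x ≡ (γ * q ^ c) % n → c % ω ≡ a % ω)
  IsEqualDiff⇒exponents-agree {E} (τ , d , n≡dτ , e , e∈E , char) E⊆C = a , agree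
    where
    a = proj₁ (E⊆C e∈E)
    e≡γqᵃ : e ≡ γ * q ^ a mod n
    e≡γqᵃ = ≡mod-trans (≡mod-reflexive (proj₂ (E⊆C e∈E))) (%≡mod _)
    term≡ : ∀ m c → (e + m * d) % n ≡ (γ * q ^ c) % n → γ * q ^ a + m * d ≡ γ * q ^ c mod n
    term≡ m c t≡ = ≡mod-trans (≡mod-+ʳ (m * d) (≡mod-sym e≡γqᵃ)) (%≡%⇒≡mod t≡)
    term : ∀ m → ∃[ c ] (γ * q ^ a + m * d ≡ γ * q ^ c mod n)
    term m = let c , t≡ = E⊆C (equalDiff-closed n≡dτ char m) in c , term≡ m c t≡
    g∣γ* : ∀ x → γ * x ≡ 0 mod g
    g∣γ* x = from ≡0mod⇔∣ (divides (γ′ * x) (trans (g*γ′ x) (*-comm g _)))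
    g∣d : g ∣ d
    g∣d = let c , t≡ = term 1 in subst (g ∣_) (*-identityˡ d) (to ≡0mod⇔∣ (begin
      1 * d                  ≈⟨ ≡mod-+ (g∣γ* (q ^ a)) (≡mod-refl {x = 1 * d}) ⟨
      γ * q ^ a + 1 * d      ≈⟨ ≡mod-∣ (divides N (trans n≡gN (*-comm g N))) t≡ ⟩
      γ * q ^ c              ≈⟨ g∣γ* (q ^ c) ⟩
      0                      ∎))
      where open ≡mod-Reasoning g
    d′ = quotient g∣d
    term÷g : ∀ m c → γ * q ^ a + m * d ≡ γ * q ^ c mod n → γ′ * q ^ a + m * d′ ≡ γ′ * q ^ c mod N
    term÷g m c t≡ = ÷g (subst₂ (λ x y → x ≡ y mod n) (g*-term m) (g*γ′ (q ^ c)) t≡)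
      where
      g*-term : ∀ m → γ * q ^ a + m * d ≡ g * (γ′ * q ^ a + m * d′)
      g*-term m = trans (cong₂ (λ x y → x + m * y) (g*γ′ (q ^ a)) (equality g∣d)) (regroup g (γ′ * q ^ a) m d′)
        where
        regroup : ∀ g x m d′ → g * x + m * (d′ * g) ≡ g * (x + m * d′)
        regroup = solve-∀
    ρ∣d′ : ρ N ∣ d′
    ρ∣d′ = ρ∣step γ′-coprime q-coprime (λ m → let c , t≡ = term m in c , term÷g m c t≡)
    agree : ∀ {x c} → E x → x ≡ (γ * q ^ c) % n → c % ω ≡ a % ω
    agree {x} {c} x∈E x≡ =
      let k , _ , x≡′ = to (char x) x∈E
          γ′qᵃ+kd′≡γ′qᶜ = ≡mod-∣ ρ∣N (term÷g k c (term≡ k c (trans (sym x≡′) x≡)))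
          γ′qᶜ≡γ′qᵃ = begin
            γ′ * q ^ c             ≈⟨ γ′qᵃ+kd′≡γ′qᶜ ⟨
            γ′ * q ^ a + k * d′    ≈⟨ ≡mod-+ˡ (γ′ * q ^ a) (from ≡0mod⇔∣ (∣n⇒∣m*n k ρ∣d′)) ⟩
            γ′ * q ^ a + 0         ≡⟨ +-identityʳ _ ⟩
            γ′ * q ^ a             ∎
      in exponents-mod-ρ (≡mod-*-cancelˡ (coprime-∣ˡ γ′-coprime ρ∣N) γ′qᶜ≡γ′qᵃ)
      where open ≡mod-Reasoning (ρ N)

  blocks-Coarser : ∀ k (E : Fin k → Subset) → IsEDDecomp n C k E → Coarser ω B k E
  blocks-Coarser k E (E-equalDiff , _ , E-covers) =
    refines⇒Coarser blocks-Disjoint blocks-Covers E-covers (λ i → blockOf (exponent i)) Eᵢ⊆B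
    where
    E⊆C : ∀ i {x} → E i x → C x
    E⊆C i x∈Eᵢ = from (E-covers _) (i , x∈Eᵢ)
    exponent : Fin k → ℕ
    exponent i = proj₁ (IsEqualDiff⇒exponents-agree (E-equalDiff i) (E⊆C i))
    Eᵢ⊆B : ∀ i {x} → E i x → B (blockOf (exponent i)) x
    Eᵢ⊆B i x∈Eᵢ =
      let c , x≡ = E⊆C i x∈Eᵢ
          c%ω≡a%ω = proj₂ (IsEqualDiff⇒exponents-agree (E-equalDiff i) (E⊆C i)) {c = c} x∈Eᵢ x≡
      in subst (λ j → B j _) (blockOf-cong c%ω≡a%ω) (⇒∈B x≡)


proposition4p1 : (q n : ℕ) .{{_ : NonZero n}} → IsPrimePower q → Coprime n q →
    (γ : ℕ) → γ < n → (o : ℕ) → IsOrd (rad (nγ n γ)) q o →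
    IsEDDecomp n (cyc n q γ) (omega n γ q o) (blocks n γ q (omega n γ q o))
    × ((k : ℕ) (E : Fin k → Subset) → IsEDDecomp n (cyc n q γ) k E →
         Coarser (omega n γ q o) (blocks n γ q (omega n γ q o)) k E)
    × ((k : ℕ) (E : Fin k → Subset) → IsEDDecomp n (cyc n q γ) k E →
         ((k' : ℕ) (E' : Fin k' → Subset) → IsEDDecomp n (cyc n q γ) k' E' → Coarser k E k' E') →
         SameBlocks k E (omega n γ q o) (blocks n γ q (omega n γ q o)))
proposition4p1 q n (p , t , p-prime , _ , q≡pᵗ) n-coprime γ _ o ord =
  blocks-IsEDDecomp , blocks-Coarser , coarsest⇒SameBlocks blocks-IsEDDecomp blocks-Coarser
  where
  g = gcd γ n
  N = nγ n γ
  instance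
    _ = subst NonZero (sym q≡pᵗ) (m^n≢0 p t {{prime⇒nonZero p-prime}})
    _ = ≢-nonZero (gcd[m,n]≢0 γ n (inj₂ (≢-nonZero⁻¹ n)))
    _ = omega-nonZero n γ q (proj₁ ord)
  n≡gN : n ≡ g * N
  n≡gN = sym (m*[n/m]≡n (gcd[m,n]∣n γ n))
  γ≡gγ′ : γ ≡ g * (γ / g)
  γ≡gγ′ = sym (m*[n/m]≡n (gcd[m,n]∣m γ n))
  q-coprime : Coprime N q
  q-coprime = coprime-∣ˡ n-coprime (divides g n≡gN)
  open CyclotomicCoset {g = g} {N = N} {γ′ = γ / g} n≡gN γ≡gγ′ (Coprime.sym (coprime-/gcd γ n)) q-coprime
                       (omega-order n γ (Coprime.sym q-coprime) ord)
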